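{- In the learning-augmented skip list built from predictions $p$, for any item $i\in[n]$ in level $\ell$, the expected search time for $i$ at level $\ell$ is at most $2$ (expectation over the randomness of the construction).
   Context: Items $[n]$ are totally ordered; predictions $p_i\in[0,1]$, $\sum_i p_i=1$. Construction: insert all items into level $0$; for $\ell=1,2,\ldots$: if level $\ell-1$ is empty, stop; otherwise for each $i$, if $p_i\ge\frac{2^{\ell-1}}{n}$ insert $i$ into level $\ell$, else if $i$ is in level $\ell-1$ insert $i$ into level $\ell$ independently with probability $\frac12$. Each level is a sorted linked list. Standard skip-list search moves forward along a level while the next item is at most the target and otherwise drops down a level; the search time at level $\ell$ is the number of steps spent on level $\ell$.
   Formalization: The predictions $p_i$ take only rational values in $[0,1]$. -}

module Defs where

open import Data.Bool using (Bool; true; false; _∧_; _∨_; not; if_then_else_)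
open import Data.Nat using (ℕ; zero; suc; _+_; _*_; _∸_; _^_; _≤ᵇ_; _<ᵇ_)
open import Data.Fin using (Fin; toℕ)
open import Data.List using (List; []; _∷_; filterᵇ; allFin; map; concatMap; last; foldr)
open import Data.Vec using (Vec; []; _∷_; lookup)
open import Data.Maybe using (Maybe; just; nothing)
open import Data.Integer using (+_)
open import Data.Rational using (ℚ; _/_; 0ℚ; _≤?_)
import Data.Rational as Q
open import Relation.Nullary using (does)

sumFinℚ : {n : ℕ} → (Fin n → ℚ) → ℚ
sumFinℚ {n} f = foldr (λ i acc → f i Q.+ acc) 0ℚ (allFin n)

sumList : {A : Set} → (A → ℕ) → List A → ℕ
sumList f = foldr (λ a acc → f a + acc) 0

ValidPredictions : (n : ℕ) → (Fin n → ℚ) → Set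
ValidPredictions n p = ((i : Fin n) → (0ℚ Q.≤ p i) Data.Product.× (p i Q.≤ Q.1ℚ))
                       Data.Product.× (sumFinℚ p ≡ Q.1ℚ)
  where open import Data.Product
        open import Relation.Binary.PropositionalEquality using (_≡_)

-- All vectors of length m with entries from a given list (uniform finite sample space).
allVecs : {A : Set} → List A → (m : ℕ) → List (Vec A m)
allVecs xs zero = [] ∷ []
allVecs xs (suc m) = concatMap (λ x → map (x ∷_) (allVecs xs m)) xs

-- Coin outcomes: for each item, one fair coin per level 1,…,L
-- (coin for level k+1 is stored at position k).
Coins : ℕ → ℕ → Set
Coins n L = Vec (Vec Bool L) n

allCoins : (n L : ℕ) → List (Coins n L)
allCoins n L = allVecs (allVecs (true ∷ false ∷ []) L) n

-- Safe lookup of the coin at position k (false beyond the stored range; never used).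
coinAt : {L : ℕ} → Vec Bool L → ℕ → Bool
coinAt [] _ = false
coinAt (b ∷ bs) zero = b
coinAt (b ∷ bs) (suc k) = coinAt bs k

-- Item i is forced into level k (k ≥ 1) iff p_i ≥ 2^(k-1)/n, i.e. n·p_i ≥ 2^(k-1).
forced : {n : ℕ} → (Fin n → ℚ) → ℕ → Fin n → Bool
forced {n} p k i = does (((+ (2 ^ (k ∸ 1))) / 1) ≤? ((+ n / 1) Q.* p i))

inLevel : {n L : ℕ} → (Fin n → ℚ) → Coins n L → Fin n → ℕ → Bool
inLevel p ω i zero = true
inLevel p ω i (suc k) = forced p (suc k) i ∨ (inLevel p ω i k ∧ coinAt (lookup ω i) k)

levelList : {n L : ℕ} → (Fin n → ℚ) → Coins n L → ℕ → List (Fin n)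
levelList {n} p ω k = filterᵇ (λ j → inLevel p ω j k) (allFin n)

-- Entry node of the search for target i at level ℓ: the node where the search
-- on level ℓ+1 ends, namely the last level-(ℓ+1) item ≤ i (nothing = head sentinel).
entryNode : {n L : ℕ} → (Fin n → ℚ) → Coins n L → Fin n → ℕ → Maybe (Fin n)
entryNode p ω i ℓ = last (filterᵇ (λ j → toℕ j ≤ᵇ toℕ i) (levelList p ω (suc ℓ)))

after : {n : ℕ} → Maybe (Fin n) → List (Fin n) → List (Fin n)
after nothing xs = xs
after (just e) xs = filterᵇ (λ j → toℕ e <ᵇ toℕ j) xs

forwardMoves : {n : ℕ} → Fin n → List (Fin n) → ℕ
forwardMoves i [] = 0
forwardMoves i (x ∷ xs) = if toℕ x ≤ᵇ toℕ i then suc (forwardMoves i xs) else 0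

-- Search time at level ℓ for target i: the forward moves along level ℓ plus the
-- one final step (failed comparison / drop down) spent on level ℓ.
searchTime : {n L : ℕ} → (Fin n → ℚ) → Coins n L → Fin n → ℕ → ℕ
searchTime p ω i ℓ = suc (forwardMoves i (after (entryNode p ω i ℓ) (levelList p ω ℓ)))

𝟙 : Bool → ℕ
𝟙 true = 1
𝟙 false = 0

-- At level ℓ the search for i takes one final step plus one step for every level-ℓ
-- item j ≤ i after the entry node, i.e. every such j with no level-(ℓ+1) item in
-- [j, i]. Flipping the level-(ℓ+1) coin of such a j is a measure-preserving
-- bijection of the coin space that leaves level ℓ unchanged and makes j the entry
-- node. An outcome has at most one entry node, so on the event i ∈ level ℓ the
-- expected number of passed items is at most the probability of that event.
module Submission where

open import Defs
open import Data.Nat using (ℕ; zero; suc; _+_; _*_; _≤_; _<_; _≤ᵇ_; _<ᵇ_; z≤n; s≤s)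
open import Data.Nat.Properties
open import Data.Fin using (Fin)
open import Data.Fin as F using (toℕ; fromℕ)
open import Data.Rational using (ℚ)
open import Data.Bool using (Bool; true; false; _∧_; _∨_; not; T)
open import Data.Bool.Properties using (T-∧; T-≡)
open import Data.List using (List; []; _∷_; _++_; filterᵇ; allFin; map; concatMap; last)
open import Data.List.Membership.Propositional using (_∈_)
open import Data.List.Membership.Propositional.Properties using (∉[]; ∈-allFin; ∈-filter⁺; ∈-filter⁻)
open import Data.List.Relation.Unary.Any using (here; there)
open import Data.List.Relation.Unary.All using (All; []; _∷_)
import Data.List.Relation.Unary.All as All
open import Data.List.Relation.Unary.AllPairs using (AllPairs; []; _∷_)
import Data.List.Relation.Unary.AllPairs.Properties as AllPairs
open import Data.Vec using (Vec; []; _∷_; lookup; updateAt)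
open import Data.Vec.Properties using (lookup∘updateAt; lookup∘updateAt′)
open import Data.Maybe using (Maybe; just; nothing)
import Data.Maybe.Properties as Maybe
open import Data.Product using (_×_; _,_; proj₁; proj₂)
open import Data.Sum using (_⊎_; inj₁; inj₂)
open import Data.Empty using (⊥; ⊥-elim)
open import Function using (_∘_; Equivalence)
open import Relation.Nullary using (¬_; Dec; yes; no; isYes)
open import Relation.Nullary.Decidable using (T?; toWitness; fromWitness)
open import Relation.Binary.PropositionalEquality
open import Algebra.Properties.CommutativeSemigroup +-commutativeSemigroup
  using () renaming (interchange to +-interchange)

module _ {A : Set} where

  sumList-cong : {f g : A → ℕ} (xs : List A) → (∀ x → f x ≡ g x) → sumList f xs ≡ sumList g xs
  sumList-cong [] f≗g = refl
  sumList-cong (x ∷ xs) f≗g = cong₂ _+_ (f≗g x) (sumList-cong xs f≗g)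

  sumList-mono : {f g : A → ℕ} (xs : List A) → (∀ x → f x ≤ g x) → sumList f xs ≤ sumList g xs
  sumList-mono [] f≤g = z≤n
  sumList-mono (x ∷ xs) f≤g = +-mono-≤ (f≤g x) (sumList-mono xs f≤g)

  sumList-+ : (f g : A → ℕ) (xs : List A) →
    sumList (λ x → f x + g x) xs ≡ sumList f xs + sumList g xs
  sumList-+ f g [] = refl
  sumList-+ f g (x ∷ xs) =
    trans (cong ((f x + g x) +_) (sumList-+ f g xs)) (+-interchange (f x) (g x) _ _)

  sumList-*ˡ : (c : ℕ) (f : A → ℕ) (xs : List A) →
    c * sumList f xs ≡ sumList (λ x → c * f x) xs
  sumList-*ˡ c f [] = *-zeroʳ c
  sumList-*ˡ c f (x ∷ xs) = trans (*-distribˡ-+ c (f x) _) (cong (c * f x +_) (sumList-*ˡ c f xs))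

  sumList-++ : (f : A → ℕ) (xs ys : List A) → sumList f (xs ++ ys) ≡ sumList f xs + sumList f ys
  sumList-++ f [] ys = refl
  sumList-++ f (x ∷ xs) ys = trans (cong (f x +_) (sumList-++ f xs ys)) (sym (+-assoc (f x) _ _))

  sumList-filterᵇ : (f : A → ℕ) (P : A → Bool) (xs : List A) →
    sumList f (filterᵇ P xs) ≡ sumList (λ x → 𝟙 (P x) * f x) xs
  sumList-filterᵇ f P [] = refl
  sumList-filterᵇ f P (x ∷ xs) with P x
  ... | true  = cong₂ _+_ (sym (+-identityʳ (f x))) (sumList-filterᵇ f P xs)
  ... | false = sumList-filterᵇ f P xs

module _ {A B : Set} where

  sumList-map : (f : B → ℕ) (g : A → B) (xs : List A) → sumList f (map g xs) ≡ sumList (f ∘ g) xs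
  sumList-map f g [] = refl
  sumList-map f g (x ∷ xs) = cong (f (g x) +_) (sumList-map f g xs)

  sumList-concatMap : (f : B → ℕ) (g : A → List B) (xs : List A) →
    sumList f (concatMap g xs) ≡ sumList (λ x → sumList f (g x)) xs
  sumList-concatMap f g [] = refl
  sumList-concatMap f g (x ∷ xs) =
    trans (sumList-++ f (g x) (concatMap g xs)) (cong (sumList f (g x) +_) (sumList-concatMap f g xs))

  sumList-swap : (F : A → B → ℕ) (xs : List A) (ys : List B) →
    sumList (λ x → sumList (F x) ys) xs ≡ sumList (λ y → sumList (λ x → F x y) xs) ys
  sumList-swap F [] ys = sym (sumList-zero ys)
    where
    sumList-zero : (ys : List B) → sumList (λ _ → 0) ys ≡ 0
    sumList-zero [] = refl
    sumList-zero (_ ∷ ys) = sumList-zero ys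
  sumList-swap F (x ∷ xs) ys =
    trans (cong (sumList (F x) ys +_) (sumList-swap F xs ys))
          (sym (sumList-+ (F x) (λ y → sumList (λ x → F x y) xs) ys))

SumInvariant : {A : Set} → (A → A) → List A → Set
SumInvariant g xs = ∀ F → sumList (F ∘ g) xs ≡ sumList F xs

module _ {A : Set} (xs : List A) where

  sumList-allVecs-suc : ∀ m (F : Vec A (suc m) → ℕ) →
    sumList F (allVecs xs (suc m)) ≡ sumList (λ x → sumList (F ∘ (x ∷_)) (allVecs xs m)) xs
  sumList-allVecs-suc m F = trans (sumList-concatMap F (λ x → map (x ∷_) (allVecs xs m)) xs)
    (sumList-cong xs (λ x → sumList-map F (x ∷_) (allVecs xs m)))

  updateAt-sumInvariant : {g : A → A} → SumInvariant g xs →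
    ∀ {m} (k : Fin m) → SumInvariant (λ v → updateAt v k g) (allVecs xs m)
  updateAt-sumInvariant {g} g-inv {suc m} F.zero F = begin
    sumList (λ v → F (updateAt v F.zero g)) (allVecs xs (suc m))
      ≡⟨ sumList-allVecs-suc m _ ⟩
    sumList ((λ x → sumList (F ∘ (x ∷_)) (allVecs xs m)) ∘ g) xs
      ≡⟨ g-inv _ ⟩
    sumList (λ x → sumList (F ∘ (x ∷_)) (allVecs xs m)) xs
      ≡⟨ sumList-allVecs-suc m F ⟨
    sumList F (allVecs xs (suc m)) ∎
    where open ≡-Reasoning
  updateAt-sumInvariant g-inv {suc m} (F.suc k) F = begin
    sumList (λ v → F (updateAt v (F.suc k) _)) (allVecs xs (suc m))
      ≡⟨ sumList-allVecs-suc m _ ⟩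
    sumList (λ x → sumList (λ v → F (x ∷ updateAt v k _)) (allVecs xs m)) xs
      ≡⟨ sumList-cong xs (λ x → updateAt-sumInvariant g-inv k (F ∘ (x ∷_))) ⟩
    sumList (λ x → sumList (F ∘ (x ∷_)) (allVecs xs m)) xs
      ≡⟨ sumList-allVecs-suc m F ⟨
    sumList F (allVecs xs (suc m)) ∎
    where open ≡-Reasoning

sumList-≤-transport : {Ω J : Set} (ωs : List Ω) (js : List J) (ψ : J → Ω → Ω) →
  (∀ j → SumInvariant (ψ j) ωs) → (g h : Ω → J → ℕ) → (∀ ω j → g ω j ≤ h (ψ j ω) j) →
  sumList (λ ω → sumList (g ω) js) ωs ≤ sumList (λ ω → sumList (h ω) js) ωs
sumList-≤-transport ωs js ψ ψ-inv g h g≤h∘ψ = begin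
  sumList (λ ω → sumList (g ω) js) ωs              ≡⟨ sumList-swap g ωs js ⟩
  sumList (λ j → sumList (λ ω → g ω j) ωs) js      ≤⟨ sumList-mono js (λ j → sumList-mono ωs (λ ω → g≤h∘ψ ω j)) ⟩
  sumList (λ j → sumList (λ ω → h (ψ j ω) j) ωs) js ≡⟨ sumList-cong js (λ j → ψ-inv j (λ ω → h ω j)) ⟩
  sumList (λ j → sumList (λ ω → h ω j) ωs) js      ≡⟨ sumList-swap h ωs js ⟨
  sumList (λ ω → sumList (h ω) js) ωs              ∎
  where open ≤-Reasoning

module _ {A : Set} where

  last-∈ : (xs : List A) {y : A} → last xs ≡ just y → y ∈ xs
  last-∈ (x ∷ []) refl = here refl
  last-∈ (x ∷ z ∷ xs) last≡y = there (last-∈ (z ∷ xs) last≡y)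

  last-nothing : (xs : List A) → last xs ≡ nothing → xs ≡ []
  last-nothing [] _ = refl
  last-nothing (x ∷ []) ()
  last-nothing (x ∷ z ∷ xs) last≡nothing with () ← last-nothing (z ∷ xs) last≡nothing

module _ {A : Set} {R : A → A → Set} where

  sumList-𝟙-atMostOne : (P : A → Bool) {xs : List A} → AllPairs R xs →
    (∀ {x y} → R x y → T (P x) → T (P y) → ⊥) → sumList (𝟙 ∘ P) xs ≤ 1
  sumList-𝟙-atMostOne P [] _ = z≤n
  sumList-𝟙-atMostOne P {x ∷ xs} (Rx ∷ sorted) exclusive with P x in Px
  ... | false = sumList-𝟙-atMostOne P sorted exclusive
  ... | true  = ≤-reflexive (cong suc (sumList-𝟙-zero xs Rx))
    where
    sumList-𝟙-zero : (ys : List A) → All (R x) ys → sumList (𝟙 ∘ P) ys ≡ 0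
    sumList-𝟙-zero [] [] = refl
    sumList-𝟙-zero (y ∷ ys) (Rxy ∷ Rxys) with P y in Py
    ... | true  = ⊥-elim (exclusive Rxy (Equivalence.from T-≡ Px) (Equivalence.from T-≡ Py))
    ... | false = sumList-𝟙-zero ys Rxys

  last-maximal : {xs : List A} → AllPairs R xs → ∀ {x y} → x ∈ xs → last xs ≡ just y → x ≡ y ⊎ R x y
  last-maximal {x ∷ []} _ (here refl) refl = inj₁ refl
  last-maximal {x ∷ z ∷ xs} (Rx ∷ _) (here refl) last≡y = inj₂ (All.lookup Rx (last-∈ (z ∷ xs) last≡y))
  last-maximal {x ∷ z ∷ xs} (_ ∷ sorted) (there x∈) last≡y = last-maximal sorted x∈ last≡y

  last-greatest : {xs : List A} → AllPairs R xs → ∀ {x} → x ∈ xs →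
    (∀ {y} → y ∈ xs → ¬ R x y) → last xs ≡ just x
  last-greatest {x ∷ []} _ (here refl) _ = refl
  last-greatest {x ∷ z ∷ xs} (Rx ∷ _) (here refl) x-top = ⊥-elim (x-top (there (here refl)) (All.head Rx))
  last-greatest {x ∷ z ∷ xs} (_ ∷ sorted) (there x∈) x-top = last-greatest sorted x∈ (x-top ∘ there)

Increasing : {n : ℕ} → List (Fin n) → Set
Increasing = AllPairs F._<_

allFin-increasing : (n : ℕ) → Increasing (allFin n)
allFin-increasing n = AllPairs.tabulate⁺-< (λ i<j → i<j)

filterᵇ-increasing : {n : ℕ} (P : Fin n → Bool) {xs : List (Fin n)} → Increasing xs → Increasing (filterᵇ P xs)
filterᵇ-increasing P = AllPairs.filter⁺ (T? ∘ P)

∈-filterᵇ⁺ : {A : Set} (P : A → Bool) {xs : List A} {x : A} → x ∈ xs → T (P x) → x ∈ filterᵇ P xs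
∈-filterᵇ⁺ P = ∈-filter⁺ (T? ∘ P)

∈-filterᵇ⁻ : {A : Set} (P : A → Bool) {xs : List A} {x : A} → x ∈ filterᵇ P xs → x ∈ xs × T (P x)
∈-filterᵇ⁻ P = ∈-filter⁻ (T? ∘ P)

forwardMoves≤count : {n : ℕ} (i : Fin n) (xs : List (Fin n)) →
  forwardMoves i xs ≤ sumList (λ j → 𝟙 (toℕ j ≤ᵇ toℕ i)) xs
forwardMoves≤count i [] = z≤n
forwardMoves≤count i (x ∷ xs) with toℕ x ≤ᵇ toℕ i
... | true  = s≤s (forwardMoves≤count i xs)
... | false = z≤n

follows : {n : ℕ} → Maybe (Fin n) → Fin n → Bool
follows nothing  _ = true
follows (just e) j = toℕ e <ᵇ toℕ j

sumList-after : {n : ℕ} (f : Fin n → ℕ) (e : Maybe (Fin n)) (xs : List (Fin n)) →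
  sumList f (after e xs) ≡ sumList (λ x → 𝟙 (follows e x) * f x) xs
sumList-after f nothing  xs = sumList-cong xs (λ x → sym (+-identityʳ (f x)))
sumList-after f (just e) xs = sumList-filterᵇ f (follows (just e)) xs

last-follows : {n : ℕ} {xs : List (Fin n)} → Increasing xs → ∀ {j x} →
  T (follows (last xs) j) → x ∈ xs → x F.< j
last-follows {xs = xs} increasing {j} {x} follows-last x∈ with last xs in last≡
... | nothing = ⊥-elim (∉[] (subst (λ ys → x ∈ ys) (last-nothing xs last≡) x∈))
... | just e with last-maximal increasing x∈ last≡
...   | inj₁ refl = <ᵇ⇒< _ _ follows-last
...   | inj₂ x<e  = <-trans x<e (<ᵇ⇒< _ _ follows-last)

not-sumInvariant : SumInvariant not (true ∷ false ∷ [])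
not-sumInvariant F rewrite +-identityʳ (F true) | +-identityʳ (F false) = +-comm (F false) (F true)

flipTop : (ℓ : ℕ) → Vec Bool (suc ℓ) → Vec Bool (suc ℓ)
flipTop ℓ v = updateAt v (fromℕ ℓ) not

coinAt-flipTop : (ℓ : ℕ) (v : Vec Bool (suc ℓ)) → coinAt (flipTop ℓ v) ℓ ≡ not (coinAt v ℓ)
coinAt-flipTop zero    (b ∷ []) = refl
coinAt-flipTop (suc ℓ) (b ∷ v)  = coinAt-flipTop ℓ v

coinAt-flipTop-below : (ℓ : ℕ) (v : Vec Bool (suc ℓ)) {m : ℕ} → m < ℓ → coinAt (flipTop ℓ v) m ≡ coinAt v m
coinAt-flipTop-below (suc ℓ) (b ∷ v) {zero}  _         = refl
coinAt-flipTop-below (suc ℓ) (b ∷ v) {suc m} (s≤s m<ℓ) = coinAt-flipTop-below ℓ v m<ℓ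

flipCoin : {n : ℕ} (ℓ : ℕ) → Fin n → Coins n (suc ℓ) → Coins n (suc ℓ)
flipCoin ℓ j ω = updateAt ω j (flipTop ℓ)

flipCoin-sumInvariant : (n ℓ : ℕ) (j : Fin n) → SumInvariant (flipCoin ℓ j) (allCoins n (suc ℓ))
flipCoin-sumInvariant n ℓ j =
  updateAt-sumInvariant _ (updateAt-sumInvariant _ not-sumInvariant (fromℕ ℓ)) j

module _ {n : ℕ} (p : Fin n → ℚ) where

  inLevel-local : {L L′ : ℕ} {ω : Coins n L} {ω′ : Coins n L′} {j : Fin n} (k : ℕ) →
    (∀ {m} → m < k → coinAt (lookup ω j) m ≡ coinAt (lookup ω′ j) m) →
    inLevel p ω j k ≡ inLevel p ω′ j k
  inLevel-local zero    _     = refl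
  inLevel-local {j = j} (suc k) agree = cong₂ (λ a c → forced p (suc k) j ∨ (a ∧ c))
    (inLevel-local k (agree ∘ m<n⇒m<1+n)) (agree (n<1+n k))

  module _ {ℓ : ℕ} (ω : Coins n (suc ℓ)) (j : Fin n) where

    coinAt-flipCoin-below : (x : Fin n) {m : ℕ} → m < ℓ →
      coinAt (lookup (flipCoin ℓ j ω) x) m ≡ coinAt (lookup ω x) m
    coinAt-flipCoin-below x m<ℓ with x F.≟ j
    ... | yes refl = trans (cong (λ v → coinAt v _) (lookup∘updateAt x ω)) (coinAt-flipTop-below ℓ (lookup ω x) m<ℓ)
    ... | no  x≢j  = cong (λ v → coinAt v _) (lookup∘updateAt′ x j x≢j ω)

    inLevel-flipCoin-≤ : (x : Fin n) {k : ℕ} → k ≤ ℓ → inLevel p (flipCoin ℓ j ω) x k ≡ inLevel p ω x k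
    inLevel-flipCoin-≤ x {k} k≤ℓ =
      inLevel-local k (λ m<k → coinAt-flipCoin-below x (<-≤-trans m<k k≤ℓ))

    inLevel-flipCoin-other : (x : Fin n) → x ≢ j → (k : ℕ) → inLevel p (flipCoin ℓ j ω) x k ≡ inLevel p ω x k
    inLevel-flipCoin-other x x≢j k = inLevel-local k (λ _ → cong (λ v → coinAt v _) (lookup∘updateAt′ x j x≢j ω))

    inLevel-flipCoin-promotes : T (inLevel p ω j ℓ) → ¬ T (inLevel p ω j (suc ℓ)) →
      T (inLevel p (flipCoin ℓ j ω) j (suc ℓ))
    inLevel-flipCoin-promotes j∈ℓ j∉ℓ+1 = subst T (sym flipped)
      (promote (forced p (suc ℓ) j) (inLevel p ω j ℓ) (coinAt (lookup ω j) ℓ) j∈ℓ j∉ℓ+1)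
      where
      flipped : inLevel p (flipCoin ℓ j ω) j (suc ℓ)
              ≡ forced p (suc ℓ) j ∨ (inLevel p ω j ℓ ∧ not (coinAt (lookup ω j) ℓ))
      flipped = cong₂ (λ a c → forced p (suc ℓ) j ∨ (a ∧ c)) (inLevel-flipCoin-≤ j ≤-refl)
        (trans (cong (λ v → coinAt v ℓ) (lookup∘updateAt j ω)) (coinAt-flipTop ℓ (lookup ω j)))

      promote : ∀ f a c → T a → ¬ T (f ∨ (a ∧ c)) → T (f ∨ (a ∧ not c))
      promote false true false _  _ = _
      promote false true true  _  ¬T = ⊥-elim (¬T _)
      promote true  _    _     _  ¬T = ⊥-elim (¬T _)

𝟙-∧ : (a b : Bool) → 𝟙 (a ∧ b) ≡ 𝟙 a * 𝟙 b
𝟙-∧ true  b = sym (+-identityʳ (𝟙 b))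
𝟙-∧ false b = refl

𝟙-mono : {a b : Bool} → (T a → T b) → 𝟙 a ≤ 𝟙 b
𝟙-mono {false} _   = z≤n
𝟙-mono {true} {true} _ = ≤-refl
𝟙-mono {true} {false} a⇒b = ⊥-elim (a⇒b _)

module SearchAtLevel {n : ℕ} (p : Fin n → ℚ) (i : Fin n) (ℓ : ℕ) where

  Ω : Set
  Ω = Coins n (suc ℓ)

  Ωs : List Ω
  Ωs = allCoins n (suc ℓ)

  candidates : Ω → List (Fin n)
  candidates ω = filterᵇ (λ j → toℕ j ≤ᵇ toℕ i) (levelList p ω (suc ℓ))

  candidates-increasing : (ω : Ω) → Increasing (candidates ω)
  candidates-increasing ω = filterᵇ-increasing _ (filterᵇ-increasing _ (allFin-increasing n))

  ∈-candidates⁺ : (ω : Ω) {k : Fin n} → T (inLevel p ω k (suc ℓ)) → toℕ k ≤ toℕ i → k ∈ candidates ω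
  ∈-candidates⁺ ω {k} k∈ℓ+1 k≤i =
    ∈-filterᵇ⁺ (λ j → toℕ j ≤ᵇ toℕ i) (∈-filterᵇ⁺ (λ j → inLevel p ω j (suc ℓ)) (∈-allFin k) k∈ℓ+1) (≤⇒≤ᵇ k≤i)

  ∈-candidates⁻ : (ω : Ω) {k : Fin n} → k ∈ candidates ω → T (inLevel p ω k (suc ℓ)) × toℕ k ≤ toℕ i
  ∈-candidates⁻ ω {k} k∈ with ∈-filterᵇ⁻ (λ j → toℕ j ≤ᵇ toℕ i) {xs = levelList p ω (suc ℓ)} k∈
  ... | k∈level , k≤ᵇi =
    proj₂ (∈-filterᵇ⁻ (λ j → inLevel p ω j (suc ℓ)) {xs = allFin n} k∈level) , ≤ᵇ⇒≤ (toℕ k) (toℕ i) k≤ᵇi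

  passed : Ω → Fin n → Bool
  passed ω j = inLevel p ω j ℓ ∧ (follows (entryNode p ω i ℓ) j ∧ (toℕ j ≤ᵇ toℕ i))

  passed⁻ : (ω : Ω) (j : Fin n) → T (passed ω j) →
    T (inLevel p ω j ℓ) × T (follows (entryNode p ω i ℓ) j) × toℕ j ≤ toℕ i
  passed⁻ ω j j-passed with Equivalence.to (T-∧ {inLevel p ω j ℓ}) j-passed
  ... | j∈ℓ , rest with Equivalence.to (T-∧ {follows (entryNode p ω i ℓ) j}) rest
  ...   | follows-entry , j≤ᵇi = j∈ℓ , follows-entry , ≤ᵇ⇒≤ (toℕ j) (toℕ i) j≤ᵇi

  isEntry? : (ω : Ω) (j : Fin n) → Dec (entryNode p ω i ℓ ≡ just j)
  isEntry? ω j = Maybe.≡-dec F._≟_ (entryNode p ω i ℓ) (just j)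

  isEntry : Ω → Fin n → Bool
  isEntry ω j = isYes (isEntry? ω j)

  searchTime≤1+passed : (ω : Ω) → searchTime p ω i ℓ ≤ suc (sumList (𝟙 ∘ passed ω) (allFin n))
  searchTime≤1+passed ω = s≤s (begin
    forwardMoves i (after e (levelList p ω ℓ))
      ≤⟨ forwardMoves≤count i (after e (levelList p ω ℓ)) ⟩
    sumList (λ j → 𝟙 (toℕ j ≤ᵇ toℕ i)) (after e (levelList p ω ℓ))
      ≡⟨ sumList-after (λ j → 𝟙 (toℕ j ≤ᵇ toℕ i)) e (levelList p ω ℓ) ⟩
    sumList (λ j → 𝟙 (follows e j) * 𝟙 (toℕ j ≤ᵇ toℕ i)) (levelList p ω ℓ)
      ≡⟨ sumList-filterᵇ (λ j → 𝟙 (follows e j) * 𝟙 (toℕ j ≤ᵇ toℕ i)) (λ j → inLevel p ω j ℓ) (allFin n) ⟩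
    sumList (λ j → 𝟙 (inLevel p ω j ℓ) * (𝟙 (follows e j) * 𝟙 (toℕ j ≤ᵇ toℕ i))) (allFin n)
      ≡⟨ sumList-cong (allFin n) (λ j → sym (trans (𝟙-∧ (inLevel p ω j ℓ) _)
           (cong (𝟙 (inLevel p ω j ℓ) *_) (𝟙-∧ (follows e j) (toℕ j ≤ᵇ toℕ i))))) ⟩
    sumList (𝟙 ∘ passed ω) (allFin n) ∎)
    where
    open ≤-Reasoning
    e = entryNode p ω i ℓ

  flipCoin-makesEntry : (ω : Ω) (j : Fin n) → T (passed ω j) → entryNode p (flipCoin ℓ j ω) i ℓ ≡ just j
  flipCoin-makesEntry ω j j-passed =
    last-greatest (candidates-increasing ω′) j∈candidates′ (λ k∈ → ≤⇒≯ (candidates′≤j k∈))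
    where
    ω′ : Ω
    ω′ = flipCoin ℓ j ω
    j∈ℓ : T (inLevel p ω j ℓ)
    j∈ℓ = proj₁ (passed⁻ ω j j-passed)
    follows-entry : T (follows (entryNode p ω i ℓ) j)
    follows-entry = proj₁ (proj₂ (passed⁻ ω j j-passed))
    j≤i : toℕ j ≤ toℕ i
    j≤i = proj₂ (proj₂ (passed⁻ ω j j-passed))
    candidates<j : ∀ {k} → k ∈ candidates ω → k F.< j
    candidates<j = last-follows (candidates-increasing ω) follows-entry
    j∉ℓ+1 : ¬ T (inLevel p ω j (suc ℓ))
    j∉ℓ+1 j∈ℓ+1 = <-irrefl refl (candidates<j (∈-candidates⁺ ω j∈ℓ+1 j≤i))
    j∈candidates′ : j ∈ candidates ω′
    j∈candidates′ = ∈-candidates⁺ ω′ (inLevel-flipCoin-promotes p ω j j∈ℓ j∉ℓ+1) j≤i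
    candidates′≤j : ∀ {k} → k ∈ candidates ω′ → toℕ k ≤ toℕ j
    candidates′≤j {k} k∈ with k F.≟ j | ∈-candidates⁻ ω′ k∈
    ... | yes refl | _ = ≤-refl
    ... | no  k≢j  | k∈ℓ+1 , k≤i = <⇒≤ (candidates<j (∈-candidates⁺ ω
      (subst T (inLevel-flipCoin-other p ω j k k≢j (suc ℓ)) k∈ℓ+1) k≤i))

  isEntry-atMostOne : (ω : Ω) → sumList (𝟙 ∘ isEntry ω) (allFin n) ≤ 1
  isEntry-atMostOne ω = sumList-𝟙-atMostOne (isEntry ω) (allFin-increasing n) λ {x} {y} x<y x-entry y-entry →
    <⇒≢ x<y (cong toℕ (Maybe.just-injective
      (trans (sym (toWitness {a? = isEntry? ω x} x-entry)) (toWitness {a? = isEntry? ω y} y-entry))))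

  𝟙[i∈ℓ] : Ω → ℕ
  𝟙[i∈ℓ] ω = 𝟙 (inLevel p ω i ℓ)

  passed-bound : sumList (λ ω → sumList (λ j → 𝟙[i∈ℓ] ω * 𝟙 (passed ω j)) (allFin n)) Ωs ≤ sumList 𝟙[i∈ℓ] Ωs
  passed-bound = begin
    sumList (λ ω → sumList (λ j → 𝟙[i∈ℓ] ω * 𝟙 (passed ω j)) (allFin n)) Ωs
      ≤⟨ sumList-≤-transport Ωs (allFin n) (flipCoin ℓ) (flipCoin-sumInvariant n ℓ) _ _ charge ⟩
    sumList (λ ω → sumList (λ j → 𝟙[i∈ℓ] ω * 𝟙 (isEntry ω j)) (allFin n)) Ωs
      ≡⟨ sumList-cong Ωs (λ ω → sumList-*ˡ (𝟙[i∈ℓ] ω) (𝟙 ∘ isEntry ω) (allFin n)) ⟨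
    sumList (λ ω → 𝟙[i∈ℓ] ω * sumList (𝟙 ∘ isEntry ω) (allFin n)) Ωs
      ≤⟨ sumList-mono Ωs (λ ω → *-monoʳ-≤ (𝟙[i∈ℓ] ω) (isEntry-atMostOne ω)) ⟩
    sumList (λ ω → 𝟙[i∈ℓ] ω * 1) Ωs
      ≡⟨ sumList-cong Ωs (λ ω → *-identityʳ (𝟙[i∈ℓ] ω)) ⟩
    sumList 𝟙[i∈ℓ] Ωs ∎
    where
    open ≤-Reasoning
    charge : ∀ ω j → 𝟙[i∈ℓ] ω * 𝟙 (passed ω j) ≤ 𝟙[i∈ℓ] (flipCoin ℓ j ω) * 𝟙 (isEntry (flipCoin ℓ j ω) j)
    charge ω j rewrite inLevel-flipCoin-≤ p ω j i (≤-refl {ℓ}) =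
      *-monoʳ-≤ (𝟙[i∈ℓ] ω) (𝟙-mono (λ j-passed → fromWitness (flipCoin-makesEntry ω j j-passed)))

mainTheorem11 : (n : ℕ) (p : Fin n → ℚ) → ValidPredictions n p →
    (i : Fin n) (ℓ : ℕ) →
    sumList (λ ω → 𝟙 (inLevel p ω i ℓ) * searchTime p ω i ℓ) (allCoins n (suc ℓ))
      ≤ 2 * sumList (λ ω → 𝟙 (inLevel p ω i ℓ)) (allCoins n (suc ℓ))
mainTheorem11 n p _ i ℓ = begin
  sumList (λ ω → 𝟙[i∈ℓ] ω * searchTime p ω i ℓ) Ωs
    ≤⟨ sumList-mono Ωs (λ ω → *-monoʳ-≤ (𝟙[i∈ℓ] ω) (searchTime≤1+passed ω)) ⟩
  sumList (λ ω → 𝟙[i∈ℓ] ω * suc (passedCount ω)) Ωs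
    ≡⟨ sumList-cong Ωs (λ ω → trans (*-suc (𝟙[i∈ℓ] ω) _)
         (cong (𝟙[i∈ℓ] ω +_) (sumList-*ˡ (𝟙[i∈ℓ] ω) _ (allFin n)))) ⟩
  sumList (λ ω → 𝟙[i∈ℓ] ω + sumList (λ j → 𝟙[i∈ℓ] ω * 𝟙 (passed ω j)) (allFin n)) Ωs
    ≡⟨ sumList-+ 𝟙[i∈ℓ] _ Ωs ⟩
  sumList 𝟙[i∈ℓ] Ωs + sumList (λ ω → sumList (λ j → 𝟙[i∈ℓ] ω * 𝟙 (passed ω j)) (allFin n)) Ωs
    ≤⟨ +-monoʳ-≤ (sumList 𝟙[i∈ℓ] Ωs) passed-bound ⟩
  sumList 𝟙[i∈ℓ] Ωs + sumList 𝟙[i∈ℓ] Ωs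
    ≡⟨ cong (sumList 𝟙[i∈ℓ] Ωs +_) (+-identityʳ _) ⟨
  2 * sumList 𝟙[i∈ℓ] Ωs ∎
  where
  open SearchAtLevel p i ℓ
  open ≤-Reasoning
  passedCount : Ω → ℕ
  passedCount ω = sumList (𝟙 ∘ passed ω) (allFin n)
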